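{- The class of linear neighborhood graphs is $\le_{\mathrm{BF}}$-complete for $\mathsf{G}\,\mathrm{FO}(<)$, i.e. it belongs to $\mathsf{G}\,\mathrm{FO}(<)$ and every graph class in $\mathsf{G}\,\mathrm{FO}(<)$ is $\le_{\mathrm{BF}}$-reducible to it.
   Context: Graphs are finite directed graphs (possibly with self-loops); a graph class is a set of finite graphs closed under isomorphism. A directed graph $G$ is a linear neighborhood graph if for all $u,v\in V(G)$ and $\alpha\in\{\mathrm{in},\mathrm{out}\}$, $N_\alpha(u)\subseteq N_\alpha(v)$ or $N_\alpha(v)\subseteq N_\alpha(u)$ (in- resp. out-neighbourhoods). For $n\ge1$, $\mathcal{N}_n$ is the structure with universe $\{0,\dots,n\}$ and the usual order $<$. $\mathrm{FO}_k(<)$ denotes first-order formulas with $k$ free variables using equality and $<$ only. A logical labeling scheme is $(\varphi,c)$ with $\varphi\in\mathrm{FO}_{2k}(<)$, $c,k\in\mathbb{N}$; a graph $G$ with $n$ vertices is in $\mathrm{gr}(\varphi,c)$ if there is $\ell\colon V(G)\to\{0,\dots,n^c\}^k$ with $(u,v)\in E(G)\iff\mathcal{N}_{n^c},(\ell(u),\ell(v))\models\varphi$ for all $u,v$. $\mathsf{G}\,\mathrm{FO}(<)$ is the set of graph classes contained in some such $\mathrm{gr}(\varphi,c)$. For a $k$-ary boolean function $f$ and graph classes $\mathcal{C}_1,\dots,\mathcal{C}_k$, $f(\mathcal{C}_1,\dots,\mathcal{C}_k)$ is the class of graphs $G$ for which there are $H_i\in\mathcal{C}_i$, all on the vertex set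 $V$ of $G$, with $(u,v)\in E(G)\iff f(x_1,\dots,x_k)=1$, $x_i=1$ iff $(u,v)\in E(H_i)$, for all distinct $u,v\in V$. $\mathcal{C}\le_{\mathrm{BF}}\mathcal{D}$ if $\mathcal{C}\subseteq f(\mathcal{D},\dots,\mathcal{D})$ for some boolean function $f$. -}

module Defs where

open import Data.Nat using (ℕ; zero; suc; _+_; _^_)
open import Data.Fin using (Fin; zero; suc; _≟_; _<?_)
open import Data.Bool using (Bool; true; false; not; _∧_; _∨_)
open import Data.Product using (Σ; ∃; _×_; _,_)
open import Data.Sum using (_⊎_)
open import Data.Vec.Functional using (Vector; _++_; _∷_)
open import Relation.Nullary using (¬_)
open import Relation.Nullary.Decidable using (⌊_⌋)
open import Relation.Binary.PropositionalEquality using (_≡_)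
open import Function.Bundles using (_↔_; Inverse)

record Graph : Set where
  constructor graph
  field
    size : ℕ
    E    : Fin size → Fin size → Bool

open Graph public

-- A graph class: a predicate on graphs (required to be isomorphism-closed
-- where the paper demands it, see IsoClosed).
GraphClass : Set₁
GraphClass = Graph → Set

_≅_ : Graph → Graph → Set
G ≅ H = Σ (Fin (size G) ↔ Fin (size H)) λ π →
          ∀ u v → E H (Inverse.to π u) (Inverse.to π v) ≡ E G u v

IsoClosed : GraphClass → Set
IsoClosed C = ∀ G H → G ≅ H → C G → C H

OutSub : (G : Graph) → Fin (size G) → Fin (size G) → Set
OutSub G u v = ∀ w → E G u w ≡ true → E G v w ≡ true

InSub : (G : Graph) → Fin (size G) → Fin (size G) → Set
InSub G u v = ∀ w → E G w u ≡ true → E G w v ≡ true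

IsLinearNeighbourhood : Graph → Set
IsLinearNeighbourhood G =
  ∀ u v → (InSub G u v ⊎ InSub G v u) × (OutSub G u v ⊎ OutSub G v u)

LN : GraphClass
LN = IsLinearNeighbourhood

-- First-order formulas over the signature {<} (with equality),
-- free variables given by de Bruijn indices in Fin k.

data FO : ℕ → Set where
  _≐_  : ∀ {k} → Fin k → Fin k → FO k
  _≺_  : ∀ {k} → Fin k → Fin k → FO k
  ¬'_  : ∀ {k} → FO k → FO k
  _∧'_ : ∀ {k} → FO k → FO k → FO k
  _∨'_ : ∀ {k} → FO k → FO k → FO k
  ∃'_  : ∀ {k} → FO (suc k) → FO k
  ∀'_  : ∀ {k} → FO (suc k) → FO k

anyFin : ∀ {m} → (Fin m → Bool) → Bool
anyFin {zero}  p = false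
anyFin {suc m} p = p zero ∨ anyFin (λ i → p (suc i))

allFin : ∀ {m} → (Fin m → Bool) → Bool
allFin {zero}  p = true
allFin {suc m} p = p zero ∧ allFin (λ i → p (suc i))

-- Satisfaction in 𝒩_M (universe {0,…,M} = Fin (suc M), usual order),
-- under an assignment of the free variables.
⟦_⟧ : ∀ {k} → FO k → (M : ℕ) → Vector (Fin (suc M)) k → Bool
⟦ i ≐ j ⟧   M ρ = ⌊ ρ i ≟ ρ j ⌋
⟦ i ≺ j ⟧   M ρ = ⌊ ρ i <? ρ j ⌋
⟦ ¬' φ ⟧    M ρ = not (⟦ φ ⟧ M ρ)
⟦ φ ∧' ψ ⟧  M ρ = ⟦ φ ⟧ M ρ ∧ ⟦ ψ ⟧ M ρ
⟦ φ ∨' ψ ⟧  M ρ = ⟦ φ ⟧ M ρ ∨ ⟦ ψ ⟧ M ρ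
⟦ ∃' φ ⟧    M ρ = anyFin (λ a → ⟦ φ ⟧ M (a ∷ ρ))
⟦ ∀' φ ⟧    M ρ = allFin (λ a → ⟦ φ ⟧ M (a ∷ ρ))

InGr : ∀ {k} → FO (k + k) → ℕ → Graph → Set
InGr {k} φ c G =
  Σ (Fin (size G) → Vector (Fin (suc (size G ^ c))) k) λ ℓ →
    ∀ u v → E G u v ≡ ⟦ φ ⟧ (size G ^ c) (ℓ u ++ ℓ v)

InGFO : GraphClass → Set
InGFO C = Σ ℕ λ k → Σ (FO (k + k)) λ φ → Σ ℕ λ c → ∀ G → C G → InGr {k} φ c G

BoolFun : ℕ → Set
BoolFun k = (Fin k → Bool) → Bool

InApply : ∀ {k} → BoolFun k → GraphClass → Graph → Set
InApply {k} f D G =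
  Σ (Fin k → Fin (size G) → Fin (size G) → Bool) λ H →
    (∀ i → D (graph (size G) (H i))) ×
    (∀ u v → ¬ (u ≡ v) → E G u v ≡ f (λ i → H i u v))

_≤BF_ : GraphClass → GraphClass → Set
C ≤BF D = Σ ℕ λ k → Σ (BoolFun k) λ f → ∀ G → C G → InApply f D G

BFCompleteForGFO : GraphClass → Set₁
BFCompleteForGFO D = InGFO D × (∀ C → IsoClosed C → InGFO C → C ≤BF D)

-- Membership: out-neighbourhoods of a linear neighbourhood graph form a chain ordered by
-- out-degree, so u → v iff every w with outDeg u ≤ outDeg w is an in-neighbour of v, a
-- comparison of two cardinalities; this is a logical labeling scheme with one ≺.
--
-- Hardness: for the points of an assignment of 𝒩_M, together with 0 and M, the truth of φ
-- depends only on the finitely many comparisons x + d ≤ y + d' with offsets d, d' ≤ T (an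
-- Ehrenfeucht–Fraïssé argument, T depending on φ), and every pattern of comparisons is
-- realised in some 𝒩_M with M bounded. So φ is a boolean function of these comparisons.
-- Each comparison, read as a relation in (u, v) for the labels ℓ u ++ ℓ v, is a Ferrers
-- relation, since each side of it depends on u alone or on v alone; and graphs whose edge
-- relation is Ferrers are linear neighbourhood graphs.
module Submission where

open import Defs
open import Data.Bool as Bool using (Bool; true; false; not; _∧_; _∨_)
open import Data.Fin as Fin using (Fin; zero; suc; toℕ; fromℕ<; fromℕ; inject₁; #_)
open import Data.Fin.Properties
  using (any?; all?; ¬∀⟶∃¬; toℕ-fromℕ<; toℕ≤pred[n]; toℕ-injective; *↔×)
open import Data.Fin.Subset using (Subset; _∈_; _∉_; _⊆_; _⊂_; ∣_∣)
open import Data.Fin.Subset.Properties using (p⊆q⇒∣p∣≤∣q∣; p⊂q⇒∣p∣<∣q∣; ∣p∣≤n)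
open import Data.Nat as ℕ
  using (ℕ; zero; suc; _+_; _∸_; _*_; _^_; _⊔_; _≤_; _<_; _≤?_; _<?_; z≤n; s≤s)
open import Data.Nat.Properties
open import Data.Product using (∃; _×_; _,_; proj₁; proj₂; map₂; swap)
open import Data.Product.Function.NonDependent.Propositional using (_×-↔_)
open import Data.Sum as Sum using (_⊎_; inj₁; inj₂; [_,_]′; fromInj₁)
open import Data.Vec using (tabulate)
open import Data.Vec.Properties using (lookup∘tabulate; []=⇒lookup; lookup⇒[]=)
open import Data.Vec.Functional using (Vector; []; _∷_; _++_; head; tail)
open import Function using (_∘_; flip; const; _⇔_; _↔_; mk⇔; Equivalence; Inverse)
open import Function.Properties.Inverse using (↔-trans)
import Function.Properties.Equivalence as ⇔
open import Function.Related.Propositional using (equivalence)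
import Function.Related.Propositional as Related
open import Relation.Nullary using (Dec; yes; no; ¬_; contradiction)
open import Relation.Nullary.Decidable using (⌊_⌋; map′; _×-dec_; _→-dec_; isYes≗does; does-⇔)
open import Relation.Unary using (Decidable)
open import Relation.Binary.PropositionalEquality

private
  variable
    A B : Set

isYes⁺ : (a? : Dec A) → A → ⌊ a? ⌋ ≡ true
isYes⁺ (yes _) _ = refl
isYes⁺ (no ¬a) a = contradiction a ¬a

isYes⁻ : (a? : Dec A) → ⌊ a? ⌋ ≡ true → A
isYes⁻ (yes a) _ = a

isNo⁺ : (a? : Dec A) → ¬ A → ⌊ a? ⌋ ≡ false
isNo⁺ (yes a) ¬a = contradiction a ¬a
isNo⁺ (no _)  _  = refl

isYes-⇔ : A ⇔ B → (a? : Dec A) (b? : Dec B) → ⌊ a? ⌋ ≡ ⌊ b? ⌋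
isYes-⇔ A⇔B a? b? = trans (isYes≗does a?) (trans (does-⇔ A⇔B a? b?) (sym (isYes≗does b?)))

isYes-≡⇒⇔ : (a? : Dec A) (b? : Dec B) → ⌊ a? ⌋ ≡ ⌊ b? ⌋ → A ⇔ B
isYes-≡⇒⇔ (yes a)  (yes b)  _ = mk⇔ (const b) (const a)
isYes-≡⇒⇔ (no ¬a) (no ¬b) _ = mk⇔ (λ a → contradiction a ¬a) (λ b → contradiction b ¬b)

bool-ext : ∀ {a b : Bool} → (a ≡ true ⇔ b ≡ true) → a ≡ b
bool-ext {true}          a⇔b = sym (Equivalence.to a⇔b refl)
bool-ext {false} {true}  a⇔b = Equivalence.from a⇔b refl
bool-ext {false} {false} _   = refl

≡-isYes : ∀ {b} → (b ≡ true ⇔ A) → (a? : Dec A) → b ≡ ⌊ a? ⌋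
≡-isYes b⇔A a? = bool-ext (⇔.trans b⇔A (mk⇔ (isYes⁺ a?) (isYes⁻ a?)))

anyFin-true : ∀ {n} {p : Fin n → Bool} → anyFin p ≡ true ⇔ ∃ λ x → p x ≡ true
anyFin-true {n} {p} = mk⇔ (to n p) (λ (x , px) → from p x px)
  where
  to : ∀ n (p : Fin n → Bool) → anyFin p ≡ true → ∃ λ x → p x ≡ true
  to (suc n) p h with p zero in p₀
  ... | true  = zero , p₀
  ... | false = let (x , px) = to n (p ∘ suc) h in suc x , px
  from : ∀ {n} (p : Fin n → Bool) x → p x ≡ true → anyFin p ≡ true
  from p zero px rewrite px = refl
  from p (suc x) px with p zero
  ... | true  = refl
  ... | false = from (p ∘ suc) x px

allFin-true : ∀ {n} {p : Fin n → Bool} → allFin p ≡ true ⇔ (∀ x → p x ≡ true)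
allFin-true {n} {p} = mk⇔ (to n p) (from n p)
  where
  to : ∀ n (p : Fin n → Bool) → allFin p ≡ true → ∀ x → p x ≡ true
  to (suc n) p h x with p zero in p₀
  to (suc n) p h zero    | true = p₀
  to (suc n) p h (suc x) | true = to n (p ∘ suc) h x
  from : ∀ n (p : Fin n → Bool) → (∀ x → p x ≡ true) → allFin p ≡ true
  from zero    p _ = refl
  from (suc n) p h rewrite h zero = from n (p ∘ suc) (h ∘ suc)

anyFin-back-and-forth : ∀ {m n} {p : Fin m → Bool} {q : Fin n → Bool} →
  (∀ x → ∃ λ y → p x ≡ q y) → (∀ y → ∃ λ x → q y ≡ p x) → anyFin p ≡ anyFin q
anyFin-back-and-forth forth back = bool-ext (mk⇔
  (λ h → let (x , px) = Equivalence.to anyFin-true h ; (y , e) = forth x in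
         Equivalence.from anyFin-true (y , trans (sym e) px))
  (λ h → let (y , qy) = Equivalence.to anyFin-true h ; (x , e) = back y in
         Equivalence.from anyFin-true (x , trans (sym e) qy)))

allFin-back-and-forth : ∀ {m n} {p : Fin m → Bool} {q : Fin n → Bool} →
  (∀ x → ∃ λ y → p x ≡ q y) → (∀ y → ∃ λ x → q y ≡ p x) → allFin p ≡ allFin q
allFin-back-and-forth forth back = bool-ext (mk⇔
  (λ h → Equivalence.from allFin-true λ y →
         let (x , e) = back y in trans e (Equivalence.to allFin-true h x))
  (λ h → Equivalence.from allFin-true λ x →
         let (y , e) = forth x in trans e (Equivalence.to allFin-true h y)))

-- Ferrers relations

Ferrers : (A → B → Bool) → Set
Ferrers R = ∀ u u' v v' → R u v ≡ true → R u' v' ≡ true → R u v' ≡ true ⊎ R u' v ≡ true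

ferrers-flip : {R : A → B → Bool} → Ferrers R → Ferrers (flip R)
ferrers-flip fR u u' v v' Rvu Rv'u' = Sum.swap (fR v v' u u' Rvu Rv'u')

ferrers-resp : {R S : A → B → Bool} → (∀ u v → R u v ≡ S u v) → Ferrers R → Ferrers S
ferrers-resp R≗S fR u u' v v' Suv Su'v' =
  Sum.map (trans (sym (R≗S u v'))) (trans (sym (R≗S u' v)))
    (fR u u' v v' (trans (R≗S u v) Suv) (trans (R≗S u' v') Su'v'))

ferrers-left : (P : A → Bool) → Ferrers {B = B} (λ u _ → P u)
ferrers-left P _ _ _ _ Pu _ = inj₁ Pu

ferrers-right : (P : B → Bool) → Ferrers {A = A} (λ _ v → P v)
ferrers-right P = ferrers-flip (ferrers-left P)

ferrers-threshold : (α : A → ℕ) (β : B → ℕ) → Ferrers (λ u v → ⌊ α u ≤? β v ⌋)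
ferrers-threshold α β u u' v v' αu≤βv αu'≤βv' with ≤-total (α u) (α u')
... | inj₁ αu≤αu' = inj₁ (isYes⁺ (α u ≤? β v') (≤-trans αu≤αu' (isYes⁻ (α u' ≤? β v') αu'≤βv')))
... | inj₂ αu'≤αu = inj₂ (isYes⁺ (α u' ≤? β v) (≤-trans αu'≤αu (isYes⁻ (α u ≤? β v) αu≤βv)))

≤?-resp : ∀ {x y : A → B → ℕ} (x' y' : A → B → ℕ) →
  (∀ u v → x u v ≡ x' u v) → (∀ u v → y u v ≡ y' u v) →
  Ferrers (λ u v → ⌊ x' u v ≤? y' u v ⌋) → Ferrers (λ u v → ⌊ x u v ≤? y u v ⌋)
≤?-resp _ _ x≡ y≡ = ferrers-resp λ u v → cong₂ (λ a b → ⌊ a ≤? b ⌋) (sym (x≡ u v)) (sym (y≡ u v))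

OneSided : (A → A → ℕ) → Set
OneSided {A} x =
  (∃ λ (g : A → ℕ) → ∀ u v → x u v ≡ g u) ⊎ (∃ λ (g : A → ℕ) → ∀ u v → x u v ≡ g v)

ferrers-oneSided : ∀ {x y : A → A → ℕ} → OneSided x → OneSided y →
  Ferrers (λ u v → ⌊ x u v ≤? y u v ⌋)
ferrers-oneSided (inj₁ (g , x≡g)) (inj₁ (h , y≡h)) =
  ≤?-resp (λ u _ → g u) (λ u _ → h u) x≡g y≡h (ferrers-left (λ u → ⌊ g u ≤? h u ⌋))
ferrers-oneSided (inj₂ (g , x≡g)) (inj₂ (h , y≡h)) =
  ≤?-resp (λ _ v → g v) (λ _ v → h v) x≡g y≡h (ferrers-right (λ v → ⌊ g v ≤? h v ⌋))
ferrers-oneSided (inj₁ (g , x≡g)) (inj₂ (h , y≡h)) =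
  ≤?-resp (λ u _ → g u) (λ _ v → h v) x≡g y≡h (ferrers-threshold g h)
ferrers-oneSided (inj₂ (g , x≡g)) (inj₁ (h , y≡h)) =
  ≤?-resp (λ _ v → g v) (λ u _ → h u) x≡g y≡h (ferrers-flip (ferrers-threshold g h))

implies? : (b c : Bool) → Dec (b ≡ true → c ≡ true)
implies? b c = (b Bool.≟ true) →-dec (c Bool.≟ true)

antecedent : ∀ {b c : Bool} → ¬ (b ≡ true → c ≡ true) → b ≡ true
antecedent {true}  _    = refl
antecedent {false} ¬b⇒c = contradiction (λ ()) ¬b⇒c

ferrers⇒OutSub-total : ∀ {n} {H : Fin n → Fin n → Bool} → Ferrers H →
  ∀ u v → OutSub (graph n H) u v ⊎ OutSub (graph n H) v u
ferrers⇒OutSub-total {n} {H} fH u v with all? (λ w → implies? (H u w) (H v w))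
... | yes u⊆v = inj₁ u⊆v
... | no u⊈v with ¬∀⟶∃¬ n _ (λ w → implies? (H u w) (H v w)) u⊈v
... | w , uw⇏vw = inj₂ λ w' vw' →
  fromInj₁ (λ vw → contradiction (const vw) uw⇏vw) (fH u v w w' (antecedent uw⇏vw) vw')

ferrers⇒LN : ∀ {n} {H : Fin n → Fin n → Bool} → Ferrers H → IsLinearNeighbourhood (graph n H)
ferrers⇒LN fH u v = ferrers⇒OutSub-total (ferrers-flip fH) u v , ferrers⇒OutSub-total fH u v

∈-tabulate⁺ : ∀ {n} {f : Fin n → Bool} {x} → f x ≡ true → x ∈ tabulate f
∈-tabulate⁺ {f = f} {x} fx = lookup⇒[]= x (tabulate f) (trans (lookup∘tabulate f x) fx)

∈-tabulate⁻ : ∀ {n} {f : Fin n → Bool} {x} → x ∈ tabulate f → f x ≡ true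
∈-tabulate⁻ {f = f} {x} x∈f = trans (sym (lookup∘tabulate f x)) ([]=⇒lookup x∈f)

tabulate-⊆ : ∀ {n} {f g : Fin n → Bool} → (∀ x → f x ≡ true → g x ≡ true) → tabulate f ⊆ tabulate g
tabulate-⊆ f⇒g x∈f = ∈-tabulate⁺ (f⇒g _ (∈-tabulate⁻ x∈f))

module DegreeLabels (G : Graph) (lnG : IsLinearNeighbourhood G) where

  outNbhd inNbhd : Fin (size G) → Subset (size G)
  outNbhd u = tabulate (E G u)
  inNbhd v = tabulate (λ w → E G w v)

  outDeg : Fin (size G) → ℕ
  outDeg u = ∣ outNbhd u ∣

  notSmaller : Fin (size G) → Subset (size G)
  notSmaller u = tabulate (λ w → ⌊ outDeg u ≤? outDeg w ⌋)

  outDeg-strict : ∀ {u v w} → OutSub G u v → E G u w ≡ false → E G v w ≡ true → outDeg u < outDeg v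
  outDeg-strict {w = w} u⊆v uw vw = p⊂q⇒∣p∣<∣q∣ (tabulate-⊆ u⊆v , w , ∈-tabulate⁺ vw , w∉u)
    where
    w∉u : w ∉ outNbhd _
    w∉u w∈u = contradiction (trans (sym uw) (∈-tabulate⁻ w∈u)) λ ()

  outDeg≤⇒OutSub : ∀ {u v} → outDeg u ≤ outDeg v → OutSub G u v
  outDeg≤⇒OutSub {u} {v} u≤v with proj₂ (lnG u v)
  ... | inj₁ u⊆v = u⊆v
  ... | inj₂ v⊆u = u⊆v
    where
    u⊆v : OutSub G u v
    u⊆v w uw with E G v w in vw
    ... | true  = refl
    ... | false = contradiction (outDeg-strict v⊆u vw uw) (≤⇒≯ u≤v)

  edge⇒notSmaller⊆inNbhd : ∀ {u v} → E G u v ≡ true → notSmaller u ⊆ inNbhd v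
  edge⇒notSmaller⊆inNbhd {u} {v} uv = tabulate-⊆ λ w u≤w →
    outDeg≤⇒OutSub (isYes⁻ (outDeg u ≤? outDeg w) u≤w) v uv

  nonedge⇒inNbhd⊂notSmaller : ∀ {u v} → E G u v ≡ false → inNbhd v ⊂ notSmaller u
  nonedge⇒inNbhd⊂notSmaller {u} {v} uv =
    tabulate-⊆ in⇒notSmaller , u , ∈-tabulate⁺ (isYes⁺ _ ≤-refl) , u∉in
    where
    in⇒notSmaller : ∀ w → E G w v ≡ true → ⌊ outDeg u ≤? outDeg w ⌋ ≡ true
    in⇒notSmaller w wv with proj₂ (lnG u w)
    ... | inj₁ u⊆w = isYes⁺ _ (p⊆q⇒∣p∣≤∣q∣ (tabulate-⊆ u⊆w))
    ... | inj₂ w⊆u = contradiction (trans (sym uv) (w⊆u v wv)) λ ()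
    u∉in : u ∉ inNbhd v
    u∉in u∈ = contradiction (trans (sym uv) (∈-tabulate⁻ u∈)) λ ()

  edge-threshold : ∀ u v → E G u v ≡ not ⌊ ∣ inNbhd v ∣ <? ∣ notSmaller u ∣ ⌋
  edge-threshold u v with E G u v in uv
  ... | true  = cong not (sym (isNo⁺ _ (≤⇒≯ (p⊆q⇒∣p∣≤∣q∣ (edge⇒notSmaller⊆inNbhd uv)))))
  ... | false = cong not (sym (isYes⁺ _ (p⊂q⇒∣p∣<∣q∣ (nonedge⇒inNbhd⊂notSmaller uv))))

  cardinality : Subset (size G) → Fin (suc (size G ^ 1))
  cardinality p = fromℕ< (s≤s (subst (∣ p ∣ ≤_) (sym (^-identityʳ (size G))) (∣p∣≤n p)))

  label : Fin (size G) → Vector (Fin (suc (size G ^ 1))) 2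
  label u = cardinality (notSmaller u) ∷ cardinality (inNbhd u) ∷ []

  -- In label u ++ label v, variable 0 is ∣ notSmaller u ∣ and variable 3 is ∣ inNbhd v ∣.
  label-correct : ∀ u v → E G u v ≡ ⟦ ¬' ((# 3) ≺ (# 0)) ⟧ (size G ^ 1) (label u ++ label v)
  label-correct u v = trans (edge-threshold u v)
    (sym (cong₂ (λ a b → not ⌊ a <? b ⌋) (toℕ-fromℕ< _) (toℕ-fromℕ< _)))

LN∈GFO : InGFO LN
LN∈GFO = 2 , ¬' ((# 3) ≺ (# 0)) , 1 , λ G lnG → label G lnG , label-correct G lnG
  where open DegreeLabels

-- Threshold types and their extension

+-cancelʳ-⇔ : ∀ c {a b} → (a + c ≤ b + c) ⇔ (a ≤ b)
+-cancelʳ-⇔ c {a} {b} = mk⇔ (+-cancelʳ-≤ c a b) (+-monoˡ-≤ c)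

+-cancelˡ-⇔ : ∀ c {a b} → (c + a ≤ c + b) ⇔ (a ≤ b)
+-cancelˡ-⇔ c {a} {b} = mk⇔ (+-cancelˡ-≤ c a b) (+-monoʳ-≤ c)

⇔-both : A → B → A ⇔ B
⇔-both a b = mk⇔ (const b) (const a)

⇔-neither : ¬ A → ¬ B → A ⇔ B
⇔-neither ¬a ¬b = mk⇔ (λ a → contradiction a ¬a) (λ b → contradiction b ¬b)

+-regroup : ∀ {x y c₁ c₂} d → x + c₁ ≡ y + c₂ → x + d + c₁ ≡ y + (c₂ + d)
+-regroup {x} {y} {c₁} {c₂} d e = begin
  x + d + c₁   ≡⟨ +-assoc x d c₁ ⟩
  x + (d + c₁) ≡⟨ cong (x +_) (+-comm d c₁) ⟩
  x + (c₁ + d) ≡⟨ +-assoc x c₁ d ⟨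
  x + c₁ + d   ≡⟨ cong (_+ d) e ⟩
  y + c₂ + d   ≡⟨ +-assoc y c₂ d ⟩
  y + (c₂ + d) ∎
  where open ≡-Reasoning

Agree : ℕ → ℕ → ℕ → ℕ → ℕ → Set
Agree T x y x' y' = ∀ {d₁ d₂} → d₁ ≤ T → d₂ ≤ T → (x + d₁ ≤ y + d₂) ⇔ (x' + d₁ ≤ y' + d₂)

infix 4 _≈[_]_
_≈[_]_ : ∀ {p} → (Fin p → ℕ) → ℕ → (Fin p → ℕ) → Set
X ≈[ T ] Y = ∀ i j → Agree T (X i) (X j) (Y i) (Y j)

≈-refl : ∀ {p T} {X : Fin p → ℕ} → X ≈[ T ] X
≈-refl i j _ _ = ⇔.refl

≈-sym : ∀ {p T} {X Y : Fin p → ℕ} → X ≈[ T ] Y → Y ≈[ T ] X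
≈-sym X≈Y i j d₁≤T d₂≤T = ⇔.sym (X≈Y i j d₁≤T d₂≤T)

≈-mono : ∀ {p T T'} {X Y : Fin p → ℕ} → T' ≤ T → X ≈[ T ] Y → X ≈[ T' ] Y
≈-mono T'≤T X≈Y i j d₁≤T' d₂≤T' = X≈Y i j (≤-trans d₁≤T' T'≤T) (≤-trans d₂≤T' T'≤T)

≈-resp : ∀ {p T} {X X' Y Y' : Fin p → ℕ} → (∀ i → X i ≡ X' i) → (∀ i → Y i ≡ Y' i) →
  X ≈[ T ] Y → X' ≈[ T ] Y'
≈-resp X≗X' Y≗Y' X≈Y i j d₁≤T d₂≤T
  rewrite sym (X≗X' i) | sym (X≗X' j) | sym (Y≗Y' i) | sym (Y≗Y' j) = X≈Y i j d₁≤T d₂≤T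

≈-transfer : ∀ {p T} {X Y : Fin p → ℕ} → X ≈[ T ] Y →
  ∀ {i j d} → d ≤ T → X i + d ≤ X j → Y i + d ≤ Y j
≈-transfer {X = X} {Y} X≈Y {i} {j} {d} d≤T le =
  subst (Y i + d ≤_) (+-identityʳ (Y j))
    (Equivalence.to (X≈Y i j d≤T z≤n) (subst (X i + d ≤_) (sym (+-identityʳ (X j))) le))

≈-≤ : ∀ {p T} {X Y : Fin p → ℕ} → X ≈[ T ] Y → ∀ {i j} → X i ≤ X j → Y i ≤ Y j
≈-≤ {X = X} {Y} X≈Y {i} {j} le = subst (_≤ Y j) (+-identityʳ (Y i))
  (≈-transfer X≈Y z≤n (subst (_≤ X j) (sym (+-identityʳ (X i))) le))

far-apart : ∀ {T x y x' y'} → (∀ {d} → d ≤ T → x + d < y) → (∀ {d} → d ≤ T → x' + d < y') →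
  Agree T x y x' y' × Agree T y x y' x'
far-apart {y = y} {y' = y'} x≪y x'≪y' =
  (λ {d₁} {d₂} d₁≤T _ → ⇔-both (<⇒≤ (<-≤-trans (x≪y d₁≤T) (m≤m+n y d₂)))
                               (<⇒≤ (<-≤-trans (x'≪y' d₁≤T) (m≤m+n y' d₂)))) ,
  (λ {d₁} {d₂} _ d₂≤T → ⇔-neither (<⇒≱ (<-≤-trans (x≪y d₂≤T) (m≤m+n y d₁)))
                                  (<⇒≱ (<-≤-trans (x'≪y' d₂≤T) (m≤m+n y' d₁))))

-- A new point anchored within T of an old one compares with the others through offsets
-- up to 2T, and an isolated one must stay T + 1 clear of the old points on both sides.
widen : ℕ → ℕ
widen T = suc (suc (T + T))

+-widen : ∀ x T → x + widen T ≡ suc (x + T) + suc T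
+-widen x T = trans (+-suc x _) (cong suc (trans (cong (x +_) (sym (+-suc T T))) (sym (+-assoc x T (suc T)))))

+-≤-widen : ∀ {a b T} → a ≤ T → b ≤ T → a + b ≤ widen T
+-≤-widen {T = T} a≤T b≤T = ≤-trans (+-mono-≤ a≤T b≤T) (m≤n+m (T + T) 2)

≤-widen : ∀ {a T} → a ≤ T → a ≤ widen T
≤-widen {T = T} a≤T = ≤-trans (≤-trans a≤T (m≤m+n T T)) (m≤n+m (T + T) 2)

argmax : ∀ {p} (X : Fin p → ℕ) {P : Fin p → Set} → Decidable P →
  (∃ λ a → P a × ∀ j → P j → X j ≤ X a) ⊎ (∀ j → ¬ P j)
argmax {zero} X P? = inj₂ λ ()
argmax {suc p} X P? with argmax (X ∘ suc) (P? ∘ suc) | P? zero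
... | inj₂ none | no ¬P₀ = inj₂ λ { zero → ¬P₀ ; (suc j) → none j }
... | inj₂ none | yes P₀ = inj₁ (zero , P₀ , λ { zero _ → ≤-refl ; (suc j) Pj → contradiction Pj (none j) })
... | inj₁ (a , Pa , max) | no ¬P₀ =
  inj₁ (suc a , Pa , λ { zero P₀ → contradiction P₀ ¬P₀ ; (suc j) → max j })
... | inj₁ (a , Pa , max) | yes P₀ with X zero ≤? X (suc a)
...   | yes X₀≤Xa = inj₁ (suc a , Pa , λ { zero _ → X₀≤Xa ; (suc j) → max j })
...   | no X₀≰Xa =
  inj₁ (zero , P₀ , λ { zero _ → ≤-refl ; (suc j) Pj → ≤-trans (max j Pj) (<⇒≤ (≰⇒> X₀≰Xa)) })

module Extension {p T} {X Y : Fin p → ℕ} (X≈Y : X ≈[ widen T ] Y) where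

  Answers : ℕ → ℕ → Set
  Answers z z' = ∀ j → Agree T z (X j) z' (Y j) × Agree T (X j) z (Y j) z'

  answers⇒≈ : ∀ {z z'} → Answers z z' → (z ∷ X) ≈[ T ] (z' ∷ Y)
  answers⇒≈ {z} {z'} _ zero zero _ _ = ⇔.trans (+-cancelˡ-⇔ z) (⇔.sym (+-cancelˡ-⇔ z'))
  answers⇒≈ ans zero    (suc j) = proj₁ (ans j)
  answers⇒≈ ans (suc i) zero    = proj₂ (ans i)
  answers⇒≈ _   (suc i) (suc j) = ≈-mono (≤-widen ≤-refl) X≈Y i j

  anchored : ∀ q {z z' c₁ c₂} → c₁ ≤ T → c₂ ≤ T → z + c₁ ≡ X q + c₂ → z' + c₁ ≡ Y q + c₂ →
    Answers z z'
  anchored q {c₁ = c₁} {c₂} c₁≤T c₂≤T zX zY j =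
    (λ {d₁} {d₂} d₁≤T d₂≤T → ⇔.trans (left (X j) d₁ d₂ zX)
      (⇔.trans (X≈Y q j (+-≤-widen c₂≤T d₁≤T) (+-≤-widen d₂≤T c₁≤T)) (⇔.sym (left (Y j) d₁ d₂ zY)))) ,
    (λ {d₁} {d₂} d₁≤T d₂≤T → ⇔.trans (right (X j) d₁ d₂ zX)
      (⇔.trans (X≈Y j q (+-≤-widen d₁≤T c₁≤T) (+-≤-widen c₂≤T d₂≤T)) (⇔.sym (right (Y j) d₁ d₂ zY))))
    where
    open Related.EquationalReasoning {k = equivalence}
    left : ∀ {x y} w d₁ d₂ → x + c₁ ≡ y + c₂ → (x + d₁ ≤ w + d₂) ⇔ (y + (c₂ + d₁) ≤ w + (d₂ + c₁))
    left {x} {y} w d₁ d₂ e = begin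
      x + d₁ ≤ w + d₂               ∼⟨ ⇔.sym (+-cancelʳ-⇔ c₁) ⟩
      x + d₁ + c₁ ≤ w + d₂ + c₁     ≡⟨ cong₂ _≤_ (+-regroup {x} {y} d₁ e) (+-assoc w d₂ c₁) ⟩
      y + (c₂ + d₁) ≤ w + (d₂ + c₁) ∎
    right : ∀ {x y} w d₁ d₂ → x + c₁ ≡ y + c₂ → (w + d₁ ≤ x + d₂) ⇔ (w + (d₁ + c₁) ≤ y + (c₂ + d₂))
    right {x} {y} w d₁ d₂ e = begin
      w + d₁ ≤ x + d₂               ∼⟨ ⇔.sym (+-cancelʳ-⇔ c₁) ⟩
      w + d₁ + c₁ ≤ x + d₂ + c₁     ≡⟨ cong₂ _≤_ (+-assoc w d₁ c₁) (+-regroup {x} {y} d₂ e) ⟩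
      w + (d₁ + c₁) ≤ y + (c₂ + d₂) ∎

  isolated : ∀ a {z} → X a + T < z → (∀ j → X j ≤ z → X j ≤ X a) → (∀ j → z < X j → z + T < X j) →
    Answers z (Y a + suc T)
  isolated a {z} XaT<z below above j with X j ≤? z
  ... | yes Xj≤z = swap (far-apart lowX lowY)
    where
    lowX : ∀ {d} → d ≤ T → X j + d < z
    lowX d≤T = ≤-<-trans (+-mono-≤ (below j Xj≤z) d≤T) XaT<z
    lowY : ∀ {d} → d ≤ T → Y j + d < Y a + suc T
    lowY d≤T = ≤-<-trans (+-mono-≤ (≈-≤ X≈Y (below j Xj≤z)) d≤T) (+-monoʳ-< (Y a) (n<1+n T))
  ... | no Xj≰z = far-apart highX highY
    where
    zT<Xj : z + T < X j
    zT<Xj = above j (≰⇒> Xj≰z)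
    highX : ∀ {d} → d ≤ T → z + d < X j
    highX d≤T = ≤-<-trans (+-monoʳ-≤ z d≤T) zT<Xj
    open ≤-Reasoning
    gap : X a + widen T ≤ X j
    gap = begin
      X a + widen T         ≡⟨ +-widen (X a) T ⟩
      suc (X a + T) + suc T ≤⟨ +-monoˡ-≤ (suc T) XaT<z ⟩
      z + suc T             ≡⟨ +-suc z T ⟩
      suc (z + T)           ≤⟨ zT<Xj ⟩
      X j                   ∎
    highY : ∀ {d} → d ≤ T → Y a + suc T + d < Y j
    highY {d} d≤T = begin-strict
      Y a + suc T + d   ≤⟨ +-monoʳ-≤ (Y a + suc T) d≤T ⟩
      Y a + suc T + T   ≡⟨ +-assoc (Y a) (suc T) T ⟩
      Y a + suc (T + T) <⟨ +-monoʳ-< (Y a) (n<1+n _) ⟩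
      Y a + widen T     ≤⟨ ≈-transfer X≈Y ≤-refl gap ⟩
      Y j               ∎

  -- If z is within T of an old point (above the largest one below z, or below some q), z'
  -- copies its offset from that point; otherwise z is isolated and z' goes T + 1 above Y a.
  answer : ∀ o → X o ≡ 0 → ∀ z → ∃ (Answers z)
  answer o Xo≡0 z with argmax X (λ j → X j ≤? z)
  ... | inj₂ nothingBelow = contradiction (subst (_≤ z) (sym Xo≡0) z≤n) (nothingBelow o)
  ... | inj₁ (a , Xa≤z , below) with z ≤? X a + T
  ...   | yes z≤XaT = Y a + (z ∸ X a) ,
          anchored a z≤n (m≤n+o⇒m∸n≤o z (X a) z≤XaT)
            (trans (+-identityʳ z) (sym (m+[n∸m]≡n Xa≤z))) (+-identityʳ _)
  ...   | no z≰XaT with any? (λ j → (z <? X j) ×-dec (X j ≤? z + T))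
  ...     | no nothingNear = Y a + suc T ,
            isolated a (≰⇒> z≰XaT) below (λ j z<Xj → ≰⇒> λ Xj≤zT → nothingNear (j , z<Xj , Xj≤zT))
  ...     | yes (q , z<Xq , Xq≤zT) = Y q ∸ e ,
            anchored q e≤T z≤n (trans (m+[n∸m]≡n (<⇒≤ z<Xq)) (sym (+-identityʳ _)))
              (trans (m∸n+n≡m e≤Yq) (sym (+-identityʳ _)))
    where
    e : ℕ
    e = X q ∸ z
    e≤T : e ≤ T
    e≤T = m≤n+o⇒m∸n≤o (X q) z Xq≤zT
    e≤Yq : e ≤ Y q
    e≤Yq = ≤-trans (m≤n+m e (Y o))
      (≈-transfer X≈Y (≤-widen e≤T) (subst (λ x → x + e ≤ X q) (sym Xo≡0) (m∸n≤m (X q) z)))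

  extend : ∀ o → X o ≡ 0 → ∀ z → ∃ λ z' → (z ∷ X) ≈[ T ] (z' ∷ Y)
  extend o Xo≡0 z = map₂ answers⇒≈ (answer o Xo≡0 z)

-- Formulas only see threshold types

-- The values of ρ followed by the endpoints 0 and M of 𝒩_M; the endpoints keep answers in
-- the extension game inside the universe.
points : ∀ {m} M → Vector (Fin (suc M)) m → Fin (suc (suc m)) → ℕ
points {zero}  M ρ zero       = 0
points {zero}  M ρ (suc zero) = M
points {suc m} M ρ zero       = toℕ (head ρ)
points {suc m} M ρ (suc i)    = points M (tail ρ) i

points-var : ∀ {m M} (ρ : Vector (Fin (suc M)) m) i → points M ρ (inject₁ (inject₁ i)) ≡ toℕ (ρ i)
points-var ρ zero    = refl
points-var ρ (suc i) = points-var (tail ρ) i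

points-origin : ∀ {m M} (ρ : Vector (Fin (suc M)) m) → points M ρ (inject₁ (fromℕ m)) ≡ 0
points-origin {zero}  ρ = refl
points-origin {suc m} ρ = points-origin (tail ρ)

points-end : ∀ {m M} (ρ : Vector (Fin (suc M)) m) → points M ρ (fromℕ (suc m)) ≡ M
points-end {zero}  ρ = refl
points-end {suc m} ρ = points-end (tail ρ)

points-cong : ∀ {m M} {ρ σ : Vector (Fin (suc M)) m} → (∀ i → ρ i ≡ σ i) →
  ∀ i → points M ρ i ≡ points M σ i
points-cong {zero}  ρ≗σ zero       = refl
points-cong {zero}  ρ≗σ (suc zero) = refl
points-cong {suc m} ρ≗σ zero       = cong toℕ (ρ≗σ zero)
points-cong {suc m} ρ≗σ (suc i)    = points-cong (ρ≗σ ∘ suc) i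

points-view : ∀ {m} M (i : Fin (suc (suc m))) →
  (∃ λ j → ∀ ρ → points M ρ i ≡ toℕ (ρ j)) ⊎ (∃ λ c → ∀ ρ → points M ρ i ≡ c)
points-view {zero}  M zero       = inj₂ (0 , λ _ → refl)
points-view {zero}  M (suc zero) = inj₂ (M , λ _ → refl)
points-view {suc m} M zero       = inj₁ (zero , λ _ → refl)
points-view {suc m} M (suc i) with points-view {m} M i
... | inj₁ (j , e) = inj₁ (suc j , e ∘ tail)
... | inj₂ (c , e) = inj₂ (c , e ∘ tail)

extendPoints : ∀ {m T M M'} {ρ : Vector (Fin (suc M)) m} {ρ' : Vector (Fin (suc M')) m} →
  points M ρ ≈[ widen T ] points M' ρ' → ∀ a → ∃ λ a' → points M (a ∷ ρ) ≈[ T ] points M' (a' ∷ ρ')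
extendPoints {m} {T} {M} {M'} {ρ} {ρ'} ρ≈ρ' a =
  fromℕ< (s≤s z'≤M') , ≈-resp (λ { zero → refl ; (suc i) → refl }) toℕ-a' a∷ρ≈z'∷ρ'
  where
  open Extension {T = T} ρ≈ρ'
  z' : ℕ
  z' = proj₁ (extend (inject₁ (fromℕ m)) (points-origin ρ) (toℕ a))
  a∷ρ≈z'∷ρ' : (toℕ a ∷ points M ρ) ≈[ T ] (z' ∷ points M' ρ')
  a∷ρ≈z'∷ρ' = proj₂ (extend (inject₁ (fromℕ m)) (points-origin ρ) (toℕ a))
  z'≤M' : z' ≤ M'
  z'≤M' = subst (z' ≤_) (points-end ρ') (≈-≤ a∷ρ≈z'∷ρ' {zero} {suc (fromℕ (suc m))}
    (subst (toℕ a ≤_) (sym (points-end ρ)) (toℕ≤pred[n] a)))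
  toℕ-a' : ∀ i → (z' ∷ points M' ρ') i ≡ points M' (fromℕ< (s≤s z'≤M') ∷ ρ') i
  toℕ-a' zero    = sym (toℕ-fromℕ< _)
  toℕ-a' (suc i) = refl

threshold : ∀ {m} → FO m → ℕ
threshold (_ ≐ _)  = 0
threshold (_ ≺ _)  = 1
threshold (¬' φ)   = threshold φ
threshold (φ ∧' ψ) = threshold φ ⊔ threshold ψ
threshold (φ ∨' ψ) = threshold φ ⊔ threshold ψ
threshold (∃' φ)   = widen (threshold φ)
threshold (∀' φ)   = widen (threshold φ)

module _ {m M M'} {ρ : Vector (Fin (suc M)) m} {ρ' : Vector (Fin (suc M')) m} where

  ≈-var-≡ : ∀ {T} → points M ρ ≈[ T ] points M' ρ' → ∀ {i j} → ρ i ≡ ρ j → ρ' i ≡ ρ' j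
  ≈-var-≡ ρ≈ρ' ρi≡ρj = toℕ-injective (≤-antisym (transport ρi≡ρj) (transport (sym ρi≡ρj)))
    where
    transport : ∀ {i j} → ρ i ≡ ρ j → toℕ (ρ' i) ≤ toℕ (ρ' j)
    transport {i} {j} e = subst₂ _≤_ (points-var ρ' i) (points-var ρ' j)
      (≈-≤ ρ≈ρ' (subst₂ _≤_ (sym (points-var ρ i)) (sym (points-var ρ j)) (≤-reflexive (cong toℕ e))))

  ≈-var-< : ∀ {T} → 1 ≤ T → points M ρ ≈[ T ] points M' ρ' →
    ∀ {i j} → toℕ (ρ i) < toℕ (ρ j) → toℕ (ρ' i) < toℕ (ρ' j)
  ≈-var-< 1≤T ρ≈ρ' {i} {j} ρi<ρj =
    subst₂ _≤_ (trans (+-comm _ 1) (cong suc (points-var ρ' i))) (points-var ρ' j)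
      (≈-transfer ρ≈ρ' 1≤T
        (subst₂ _≤_ (trans (cong suc (sym (points-var ρ i))) (+-comm 1 _)) (sym (points-var ρ j)) ρi<ρj))

⟦⟧-invariant : ∀ {m M M'} (φ : FO m) {ρ : Vector (Fin (suc M)) m} {ρ' : Vector (Fin (suc M')) m} →
  points M ρ ≈[ threshold φ ] points M' ρ' → ⟦ φ ⟧ M ρ ≡ ⟦ φ ⟧ M' ρ'

extend-⟦_⟧ : ∀ {m M M'} (φ : FO (suc m)) {ρ : Vector (Fin (suc M)) m} {ρ' : Vector (Fin (suc M')) m} →
  points M ρ ≈[ widen (threshold φ) ] points M' ρ' →
  ∀ a → ∃ λ a' → ⟦ φ ⟧ M (a ∷ ρ) ≡ ⟦ φ ⟧ M' (a' ∷ ρ')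

⟦⟧-invariant (i ≐ j) ρ≈ρ' = isYes-⇔ (mk⇔ (≈-var-≡ ρ≈ρ') (≈-var-≡ (≈-sym ρ≈ρ'))) _ _
⟦⟧-invariant (i ≺ j) ρ≈ρ' = isYes-⇔ (mk⇔ (≈-var-< ≤-refl ρ≈ρ') (≈-var-< ≤-refl (≈-sym ρ≈ρ'))) _ _
⟦⟧-invariant (¬' φ) ρ≈ρ' = cong not (⟦⟧-invariant φ ρ≈ρ')
⟦⟧-invariant (φ ∧' ψ) ρ≈ρ' =
  cong₂ _∧_ (⟦⟧-invariant φ (≈-mono (m≤m⊔n _ _) ρ≈ρ')) (⟦⟧-invariant ψ (≈-mono (m≤n⊔m _ _) ρ≈ρ'))
⟦⟧-invariant (φ ∨' ψ) ρ≈ρ' =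
  cong₂ _∨_ (⟦⟧-invariant φ (≈-mono (m≤m⊔n _ _) ρ≈ρ')) (⟦⟧-invariant ψ (≈-mono (m≤n⊔m _ _) ρ≈ρ'))
⟦⟧-invariant (∃' φ) ρ≈ρ' = anyFin-back-and-forth (extend-⟦ φ ⟧ ρ≈ρ') (extend-⟦ φ ⟧ (≈-sym ρ≈ρ'))
⟦⟧-invariant (∀' φ) ρ≈ρ' = allFin-back-and-forth (extend-⟦ φ ⟧ ρ≈ρ') (extend-⟦ φ ⟧ (≈-sym ρ≈ρ'))

extend-⟦_⟧ φ ρ≈ρ' a = map₂ (⟦⟧-invariant φ) (extendPoints ρ≈ρ' a)

bound : ℕ → ℕ → ℕ
bound T zero    = suc T
bound T (suc m) = bound (widen T) m

points-far-end : ∀ {T M M'} {ρ : Vector (Fin (suc M)) 0} {ρ' : Vector (Fin (suc M')) 0} →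
  T < M → T < M' → points M ρ ≈[ T ] points M' ρ'
points-far-end T<M T<M' zero zero = λ _ _ → ⇔.refl
points-far-end {M = M} {M'} T<M T<M' (suc zero) (suc zero) =
  λ _ _ → ⇔.trans (+-cancelˡ-⇔ M) (⇔.sym (+-cancelˡ-⇔ M'))
points-far-end T<M T<M' zero (suc zero) =
  proj₁ (far-apart (λ d≤T → ≤-<-trans d≤T T<M) (λ d≤T → ≤-<-trans d≤T T<M'))
points-far-end T<M T<M' (suc zero) zero =
  proj₂ (far-apart (λ d≤T → ≤-<-trans d≤T T<M) (λ d≤T → ≤-<-trans d≤T T<M'))

compress : ∀ m T M (ρ : Vector (Fin (suc M)) m) →
  ∃ λ M₀ → M₀ ≤ bound T m × ∃ λ (ρ₀ : Vector (Fin (suc M₀)) m) → points M ρ ≈[ T ] points M₀ ρ₀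
compress zero T M ρ with M ≤? T
... | yes M≤T = M , m≤n⇒m≤1+n M≤T , ρ , ≈-refl
... | no M≰T  = suc T , ≤-refl , [] , points-far-end (≰⇒> M≰T) ≤-refl
compress (suc m) T M ρ with compress m (widen T) M (tail ρ)
... | M₀ , M₀≤ , ρ₀ , tail≈ρ₀ with extendPoints tail≈ρ₀ (head ρ)
...   | a₀ , ρ≈a₀∷ρ₀ =
  M₀ , M₀≤ , a₀ ∷ ρ₀ , ≈-resp (λ { zero → refl ; (suc i) → refl }) (λ _ → refl) ρ≈a₀∷ρ₀

Code : ℕ → ℕ → Set
Code p S = (Fin p × Fin p) × (Fin S × Fin S)

codes : ∀ p S → Fin ((p * p) * (S * S)) ↔ Code p S
codes _ _ = ↔-trans *↔× (*↔× ×-↔ *↔×)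

bit : ∀ {p S} → (Fin p → ℕ) → Code p S → Bool
bit X ((i , j) , (d₁ , d₂)) = ⌊ X i + toℕ d₁ ≤? X j + toℕ d₂ ⌋

bits : ∀ {p} S → (Fin p → ℕ) → Fin ((p * p) * (S * S)) → Bool
bits {p} S X = bit X ∘ Inverse.to (codes p S)

bits-cong : ∀ {p} S {X Y : Fin p → ℕ} → (∀ i → X i ≡ Y i) → ∀ t → bits S X t ≡ bits S Y t
bits-cong S X≗Y t = cong₂ (λ a b → ⌊ a ≤? b ⌋) (cong (_+ _) (X≗Y _)) (cong (_+ _) (X≗Y _))

≈⇔bits : ∀ {p T} {X Y : Fin p → ℕ} → X ≈[ T ] Y ⇔ (∀ t → bits (suc T) X t ≡ bits (suc T) Y t)
≈⇔bits {p} {T} {X} {Y} = mk⇔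
  (λ X≈Y t → let ((i , j) , (d₁ , d₂)) = Inverse.to (codes p (suc T)) t in
    isYes-⇔ (X≈Y i j (toℕ≤pred[n] d₁) (toℕ≤pred[n] d₂)) _ _)
  bits⇒≈
  where
  bits⇒≈ : (∀ t → bits (suc T) X t ≡ bits (suc T) Y t) → X ≈[ T ] Y
  bits⇒≈ bits≡ i j {d₁} {d₂} d₁≤T d₂≤T
    rewrite sym (toℕ-fromℕ< (s≤s d₁≤T)) | sym (toℕ-fromℕ< (s≤s d₂≤T)) = isYes-≡⇒⇔ _ _ bit≡
    where
    c : Code p (suc T)
    c = (i , j) , (fromℕ< (s≤s d₁≤T) , fromℕ< (s≤s d₂≤T))
    bit≡ : bit X c ≡ bit Y c
    bit≡ = subst (λ c' → bit X c' ≡ bit Y c') (Inverse.strictlyInverseˡ (codes p (suc T)) c)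
      (bits≡ (Inverse.from (codes p (suc T)) c))

points-oneSided : ∀ {k M n} (ℓ : Fin n → Vector (Fin (suc M)) k) i d →
  OneSided (λ u v → points M (ℓ u ++ ℓ v) i + d)
points-oneSided {k} {M} ℓ i d with points-view M i
... | inj₂ (c , e) = inj₁ ((λ _ → c + d) , λ u v → cong (_+ d) (e _))
... | inj₁ (j , e) with Fin.splitAt k j in split
...   | inj₁ j' = inj₁ ((λ u → toℕ (ℓ u j') + d) ,
          λ u v → cong (_+ d) (trans (e _) (cong (λ s → toℕ ([ ℓ u , ℓ v ]′ s)) split)))
...   | inj₂ j' = inj₂ ((λ v → toℕ (ℓ v j') + d) ,
          λ u v → cong (_+ d) (trans (e _) (cong (λ s → toℕ ([ ℓ u , ℓ v ]′ s)) split)))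

bitGraph-LN : ∀ {k M n} (ℓ : Fin n → Vector (Fin (suc M)) k) S t →
  IsLinearNeighbourhood (graph n λ u v → bits S (points M (ℓ u ++ ℓ v)) t)
bitGraph-LN ℓ S t = let ((i , j) , (d₁ , d₂)) = Inverse.to (codes _ S) t in
  ferrers⇒LN (ferrers-oneSided (points-oneSided ℓ i (toℕ d₁)) (points-oneSided ℓ j (toℕ d₂)))

anyVector? : ∀ {m n} {P : Vector (Fin n) m → Set} → (∀ {σ τ} → (∀ i → σ i ≡ τ i) → P σ → P τ) →
  (∀ σ → Dec (P σ)) → Dec (∃ P)
anyVector? {zero} resp P? = map′ ([] ,_) (λ (σ , p) → resp (λ ()) p) (P? [])
anyVector? {suc m} resp P? =
  map′ (λ (a , σ , p) → a ∷ σ , p)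
       (λ (σ , p) → head σ , tail σ , resp (λ { zero → refl ; (suc i) → refl }) p)
    (any? λ a → anyVector? (λ σ≗τ → resp λ { zero → refl ; (suc i) → σ≗τ i }) (P? ∘ (a ∷_)))

module Reduction {k} (φ : FO (k + k)) where

  T : ℕ
  T = threshold φ

  K : ℕ
  K = (suc (suc (k + k)) * suc (suc (k + k))) * (suc T * suc T)

  RealisedBy : (Fin K → Bool) → ∀ M₀ → Vector (Fin (suc M₀)) (k + k) → Set
  RealisedBy b M₀ ρ₀ = (∀ t → b t ≡ bits (suc T) (points M₀ ρ₀) t) × ⟦ φ ⟧ M₀ ρ₀ ≡ true

  RealisedBy-resp : ∀ {b M₀} {σ τ : Vector (Fin (suc M₀)) (k + k)} → (∀ i → σ i ≡ τ i) →
    RealisedBy b M₀ σ → RealisedBy b M₀ τ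
  RealisedBy-resp σ≗τ (b≡ , φσ) =
    (λ t → trans (b≡ t) (bits-cong (suc T) (points-cong σ≗τ) t)) ,
    trans (sym (⟦⟧-invariant φ (≈-resp (λ _ → refl) (points-cong σ≗τ) ≈-refl))) φσ

  Realisable : (Fin K → Bool) → Set
  Realisable b = ∃ λ (M₀ : Fin (suc (bound T (k + k)))) → ∃ (RealisedBy b (toℕ M₀))

  realisable? : ∀ b → Dec (Realisable b)
  realisable? b = any? λ M₀ → anyVector? RealisedBy-resp λ ρ₀ →
    all? (λ t → b t Bool.≟ bits (suc T) (points (toℕ M₀) ρ₀) t)
      ×-dec (⟦ φ ⟧ (toℕ M₀) ρ₀ Bool.≟ true)

  f : BoolFun K
  f b = ⌊ realisable? b ⌋

  ⟦⟧≡f∘bits : ∀ M (ρ : Vector (Fin (suc M)) (k + k)) → ⟦ φ ⟧ M ρ ≡ f (bits (suc T) (points M ρ))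
  ⟦⟧≡f∘bits M ρ = ≡-isYes (mk⇔ compressed realised) (realisable? _)
    where
    compressed : ⟦ φ ⟧ M ρ ≡ true → Realisable (bits (suc T) (points M ρ))
    compressed φρ with compress (k + k) T M ρ
    ... | M₀ , M₀≤ , ρ₀ , ρ≈ρ₀ = fromℕ< (s≤s M₀≤) , subst (∃ ∘ RealisedBy _) (sym (toℕ-fromℕ< _))
          (ρ₀ , Equivalence.to ≈⇔bits ρ≈ρ₀ , trans (sym (⟦⟧-invariant φ ρ≈ρ₀)) φρ)
    realised : Realisable (bits (suc T) (points M ρ)) → ⟦ φ ⟧ M ρ ≡ true
    realised (M₀ , ρ₀ , b≡ , φρ₀) = trans (⟦⟧-invariant φ (Equivalence.from ≈⇔bits b≡)) φρ₀

LN-hard : ∀ C → InGFO C → C ≤BF LN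
LN-hard C (k , φ , c , C⊆gr) = K , f , λ G G∈C →
  let (ℓ , ℓ-correct) = C⊆gr G G∈C in
  (λ t u v → bits (suc T) (points (size G ^ c) (ℓ u ++ ℓ v)) t) ,
  bitGraph-LN ℓ (suc T) ,
  (λ u v _ → trans (ℓ-correct u v) (⟦⟧≡f∘bits _ _))
  where open Reduction {k} φ

theorem6p22 : BFCompleteForGFO LN
theorem6p22 = LN∈GFO , λ C _ → LN-hard C
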